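{- Let $G$ be a connected graph such that $\mathrm{Aut}(G[G])=\mathrm{Aut}(G)[\mathrm{Aut}(G)]$. Then $D'(G^k)\leq 2$ for every $k\geq 2$.
   Context: All graphs are finite and simple. For a graph $X$, an edge labeling $\psi:E(X)\to\{1,\dots,d\}$ is distinguishing if the only automorphism of $X$ preserving all edge labels is the identity; the distinguishing index $D'(X)$ is the least $d$ such that $X$ has a distinguishing edge labeling with $d$ labels. The lexicographic product $G[H]$ has vertex set $V(G)\times V(H)$, with $(a,x)$ adjacent to $(b,y)$ iff $ab\in E(G)$, or $a=b$ and $xy\in E(H)$. Lexicographic powers: $G^1=G$, $G^k=G[G^{k-1}]$ for $k\geq 2$. The wreath product $\mathrm{Aut}(G)[\mathrm{Aut}(H)]$ is the subgroup of $\mathrm{Aut}(G[H])$ consisting of all maps $(g,h)\mapsto(\alpha g,\beta_g h)$ with $\alpha\in\mathrm{Aut}(G)$ and $\beta_g\in\mathrm{Aut}(H)$ for each $g\in V(G)$. -}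

module Defs where

open import Data.Nat using (ℕ; zero; suc; _*_; _≤_)
open import Data.Fin using (Fin; remQuot; combine; _≟_)
open import Data.Bool using (Bool; true; false; _∨_; _∧_)
open import Data.Product using (Σ; _×_; _,_; proj₁; proj₂; ∃)
open import Relation.Nullary using (yes; no)
open import Relation.Nullary.Decidable using (⌊_⌋)
open import Relation.Binary.PropositionalEquality
  using (_≡_; refl; sym; cong; cong₂)

record Graph : Set where
  field
    order  : ℕ
    adj    : Fin order → Fin order → Bool
    adj-sym    : ∀ x y → adj x y ≡ adj y x
    adj-irrefl : ∀ x → adj x x ≡ false

open Graph public

Vertex : Graph → Set
Vertex X = Fin (order X)

data Reach (X : Graph) : Vertex X → Vertex X → Set where
  here : ∀ {x} → Reach X x x
  step : ∀ {x y z} → adj X x y ≡ true → Reach X y z → Reach X x z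

Connected : Graph → Set
Connected X = ∀ x y → Reach X x y

record Aut (X : Graph) : Set where
  field
    fun : Vertex X → Vertex X
    inv : Vertex X → Vertex X
    inv-left  : ∀ x → inv (fun x) ≡ x
    inv-right : ∀ x → fun (inv x) ≡ x
    preserves : ∀ x y → adj X (fun x) (fun y) ≡ adj X x y

open Aut public

-- Edge labelings with labels Fin d (the labels 1..d); the label of the
-- unordered edge xy is ψ x y, which must not depend on orientation.
record EdgeLabeling (X : Graph) (d : ℕ) : Set where
  field
    label     : Vertex X → Vertex X → Fin d
    label-sym : ∀ x y → adj X x y ≡ true → label x y ≡ label y x

open EdgeLabeling public

PreservesLabels : {X : Graph} {d : ℕ} → EdgeLabeling X d → Aut X → Set
PreservesLabels {X} ψ f =
  ∀ x y → adj X x y ≡ true → label ψ (fun f x) (fun f y) ≡ label ψ x y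

Distinguishing : {X : Graph} {d : ℕ} → EdgeLabeling X d → Set
Distinguishing {X} ψ = ∀ (f : Aut X) → PreservesLabels ψ f → ∀ x → fun f x ≡ x

HasDistinguishingLabeling : Graph → ℕ → Set
HasDistinguishingLabeling X d = Σ (EdgeLabeling X d) Distinguishing

-- D'(X) ≤ d : the least d' admitting a distinguishing labeling is ≤ d,
-- i.e. some d' ≤ d admits one.
DistIndex≤ : Graph → ℕ → Set
DistIndex≤ X d = Σ ℕ λ d' → d' ≤ d × HasDistinguishingLabeling X d'

-- Lexicographic product. Vertex (a , x) of V(G) × V(H) is encoded as
-- combine a x : Fin (order G * order H), with inverse remQuot.
eqb : ∀ {n} → Fin n → Fin n → Bool
eqb a b = ⌊ a ≟ b ⌋

private
  eqb-sym : ∀ {n} (a b : Fin n) → eqb a b ≡ eqb b a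
  eqb-sym a b with a ≟ b | b ≟ a
  ... | yes _ | yes _ = refl
  ... | no _  | no _  = refl
  ... | yes p | no q  with q (sym p)
  ... | ()
  eqb-sym a b | no q | yes p with q (sym p)
  ... | ()

  eqb-refl : ∀ {n} (a : Fin n) → eqb a a ≡ true
  eqb-refl a with a ≟ a
  ... | yes _ = refl
  ... | no q with q refl
  ... | ()

lexAdj : (G H : Graph) → Fin (order G * order H) → Fin (order G * order H) → Bool
lexAdj G H u v = lexAdj′ G H (remQuot {order G} (order H) u) (remQuot {order G} (order H) v)
  where
  lexAdj′ : (G H : Graph) → Vertex G × Vertex H → Vertex G × Vertex H → Bool
  lexAdj′ G H (a , x) (b , y) = adj G a b ∨ (eqb a b ∧ adj H x y)

private
  lexAdj-sym : ∀ G H u v → lexAdj G H u v ≡ lexAdj G H v u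
  lexAdj-sym G H u v =
    cong₂ _∨_ (adj-sym G a b) (cong₂ _∧_ (eqb-sym a b) (adj-sym H x y))
    where
    a = proj₁ (remQuot {order G} (order H) u)
    x = proj₂ (remQuot {order G} (order H) u)
    b = proj₁ (remQuot {order G} (order H) v)
    y = proj₂ (remQuot {order G} (order H) v)

  lexAdj-irrefl : ∀ G H u → lexAdj G H u u ≡ false
  lexAdj-irrefl G H u with proj₁ (remQuot {order G} (order H) u) | proj₂ (remQuot {order G} (order H) u)
  ... | a | x rewrite adj-irrefl G a | eqb-refl a | adj-irrefl H x = refl

_[_] : Graph → Graph → Graph
G [ H ] = record
  { order = order G * order H
  ; adj = lexAdj G H
  ; adj-sym = lexAdj-sym G H
  ; adj-irrefl = lexAdj-irrefl G H
  }

-- Lexicographic powers: G^1 = G, G^k = G[G^(k-1)] for k ≥ 2.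
-- (The value at k = 0 is an irrelevant junk value, set to G.)
lexPow : Graph → ℕ → Graph
lexPow G zero = G
lexPow G (suc zero) = G
lexPow G (suc (suc k)) = G [ lexPow G (suc k) ]

InWreath : (G H : Graph) → Aut (G [ H ]) → Set
InWreath G H φ =
  Σ (Aut G) λ α → Σ (Vertex G → Aut H) λ β →
    ∀ (g : Vertex G) (h : Vertex H) →
      fun φ (combine g h) ≡ combine (fun α g) (fun (β g) h)

-- Aut(G[H]) = Aut(G)[Aut(H)]  (the wreath product is by definition a subset
-- of Aut(G[H]); equality means every automorphism of G[H] lies in it).
AutLexIsWreath : Graph → Graph → Set
AutLexIsWreath G H = ∀ (φ : Aut (G [ H ])) → InWreath G H φ

module Submission where

-- Write G^k = G[H] with H = G^(k-1).  Graphs with at most one vertex are trivial, and a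
-- connected G on two vertices is an edge, which violates the hypothesis; so |H| ≥ |G| ≥ 3.
--
-- If an automorphism of G[H] split a layer {a} × H over two layers b ≢ c, then b and c would
-- be adjacent true twins of G and H would be the join of two graphs, and a join structure on
-- H = G^(k-1) descends to G.  But for true twins b, c and a join V(G) = P ∪ Q, transposing b
-- and c in exactly the layers indexed by P is an automorphism of G[G] outside the wreath
-- product.  Hence every automorphism of G[H] is (a, x) ↦ (α a, β_a x).
--
-- Label an edge between layers a < b by whether x ≤ y, and an edge
-- inside layer a by whether it meets vertex a of H.  If the labels are preserved, then along
-- every edge of G the maps β_a, β_b are both the identity or both the order reversal;
-- connectivity of G and the marks of the first layer exclude reversal, and then the marks
-- determine each layer, so α is the identity as well.

open import Defs
open import Data.Bool using (Bool; true; false; not; _∨_; _∧_; if_then_else_)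
open import Data.Bool.Properties using (∨-comm; ∨-identityʳ; ∨-zeroʳ; ∧-identityʳ; ∧-zeroʳ; T-≡; ⇔→≡)
open import Data.Empty using (⊥; ⊥-elim)
open import Data.Fin as Fin using (Fin; remQuot; combine; toℕ; fromℕ<; opposite; punchIn; punchOut; _≟_)
open import Data.Fin.Patterns using (0F; 1F)
open import Data.Fin.Permutation.Components using (transpose; transpose-inverse)
import Data.Fin.Properties as Finₚ
open import Data.Nat as ℕ using (ℕ; zero; suc; _≤_; z≤n; s≤s)
import Data.Nat.Properties as ℕₚ
open import Data.Product using (_×_; _,_; proj₁; proj₂; ∃)
open import Data.Sum using (_⊎_; inj₁; inj₂)
open import Function using (_∘_; _⇔_; mk⇔; Equivalence; const)
open import Function.Bundles using (Inverse)
open import Function.Definitions using (Injective)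
open import Function.Properties.Equivalence using () renaming (trans to ⇔-trans)
open import Relation.Binary.Definitions using (tri<; tri≈; tri>)
open import Relation.Binary.PropositionalEquality hiding ([_])
open import Relation.Nullary using (¬_; Dec; does; yes; no; contradiction)
open import Relation.Nullary.Decidable using (isYes≗does; dec-true; dec-false)

private
  variable
    k : ℕ
    X : Graph

eqb-refl : (a : Fin k) → eqb a a ≡ true
eqb-refl a = trans (isYes≗does (a ≟ a)) (dec-true (a ≟ a) refl)

eqb-≢ : {a b : Fin k} → a ≢ b → eqb a b ≡ false
eqb-≢ {a = a} {b} a≢b = trans (isYes≗does (a ≟ b)) (dec-false (a ≟ b) a≢b)

≡⇒eqb : {a b : Fin k} → a ≡ b → eqb a b ≡ true
≡⇒eqb {a = a} refl = eqb-refl a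

eqb⇒≡ : {a b : Fin k} → eqb a b ≡ true → a ≡ b
eqb⇒≡ {a = a} {b} e with a ≟ b
... | yes a≡b = a≡b

eqb-false⇒≢ : {a b : Fin k} → eqb a b ≡ false → a ≢ b
eqb-false⇒≢ {a = a} e refl = contradiction (trans (sym e) (eqb-refl a)) λ ()

eqb-sym : (a b : Fin k) → eqb a b ≡ eqb b a
eqb-sym a b with a ≟ b
... | yes refl = sym (eqb-refl a)
... | no a≢b = sym (eqb-≢ (a≢b ∘ sym))

does-≡⇒⇔ : ∀ {A B : Set} (a? : Dec A) (b? : Dec B) → does a? ≡ does b? → A ⇔ B
does-≡⇒⇔ (yes a) (yes b) _  = mk⇔ (const b) (const a)
does-≡⇒⇔ (no ¬a) (no ¬b) _  = mk⇔ (λ a → contradiction a ¬a) (λ b → contradiction b ¬b)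
does-≡⇒⇔ (yes _) (no _)  ()
does-≡⇒⇔ (no _)  (yes _) ()

bit : Bool → Fin 2
bit = Inverse.from Finₚ.2↔Bool

bit-injective : Injective _≡_ _≡_ bit
bit-injective {x} {y} e = trans (sym (to∘from x)) (trans (cong (Inverse.to Finₚ.2↔Bool) e) (to∘from y))
  where to∘from = Inverse.strictlyInverseˡ Finₚ.2↔Bool

∃-≢ : 2 ≤ k → (x : Fin k) → ∃ λ y → x ≢ y
∃-≢ {suc zero} (s≤s ()) _
∃-≢ {suc (suc _)} _ x = punchIn x Fin.zero , Finₚ.punchInᵢ≢i x Fin.zero ∘ sym

injective⇒surjective : (h : Fin k → Fin k) → Injective _≡_ _≡_ h → ∀ s → ∃ λ z → h z ≡ s
injective⇒surjective {zero}  h inj ()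
injective⇒surjective {suc k} h inj s with Finₚ.any? (λ z → h z ≟ s)
... | yes hit = hit
... | no miss = contradiction (Finₚ.injective⇒≤ squeeze-injective) (ℕₚ.<-irrefl refl)
  where
  s≢h : ∀ z → s ≢ h z
  s≢h z s≡hz = miss (z , sym s≡hz)
  squeeze : Fin (suc k) → Fin k
  squeeze z = punchOut (s≢h z)
  squeeze-injective : Injective _≡_ _≡_ squeeze
  squeeze-injective {z} {z′} e = inj (Finₚ.punchOut-injective (s≢h z) (s≢h z′) e)

Fin2-cases : (a b c : Fin 2) → a ≢ b → c ≡ a ⊎ c ≡ b
Fin2-cases 0F 0F _  a≢b = contradiction refl a≢b
Fin2-cases 1F 1F _  a≢b = contradiction refl a≢b
Fin2-cases 0F 1F 0F _   = inj₁ refl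
Fin2-cases 0F 1F 1F _   = inj₂ refl
Fin2-cases 1F 0F 0F _   = inj₂ refl
Fin2-cases 1F 0F 1F _   = inj₁ refl

only-two : k ≡ 2 → (a b c : Fin k) → a ≢ b → c ≡ a ⊎ c ≡ b
only-two refl = Fin2-cases

opposite-≤ : (x y : Fin k) → opposite x Fin.≤ opposite y ⇔ y Fin.≤ x
opposite-≤ {k} x y = mk⇔ to from
  where
  from : y Fin.≤ x → opposite x Fin.≤ opposite y
  from y≤x rewrite Finₚ.opposite-prop x | Finₚ.opposite-prop y = ℕₚ.∸-monoʳ-≤ k (s≤s y≤x)
  to : opposite x Fin.≤ opposite y → y Fin.≤ x
  to ox≤oy = ℕₚ.≮⇒≥ λ x<y → ℕₚ.<⇒≱ (flip x<y) ox≤oy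
    where
    flip : x Fin.< y → opposite y Fin.< opposite x
    flip x<y rewrite Finₚ.opposite-prop x | Finₚ.opposite-prop y = ℕₚ.∸-monoʳ-< (s≤s x<y) (Finₚ.toℕ<n y)

opposite-< : {x y : Fin k} → x Fin.< y → opposite y Fin.< opposite x
opposite-< {x = x} {y} x<y = ℕₚ.≰⇒> (ℕₚ.<⇒≱ x<y ∘ Equivalence.to (opposite-≤ x y))

StrictlyIncreasing : (Fin k → Fin k) → Set
StrictlyIncreasing g = ∀ {x y} → x Fin.< y → g x Fin.< g y

strictlyIncreasing⇒≥ : (g : Fin k → Fin k) → StrictlyIncreasing g → ∀ x → x Fin.≤ g x
strictlyIncreasing⇒≥ {k} g incr x = below (toℕ x) x refl
  where
  below : ∀ j (x : Fin k) → toℕ x ≡ j → j ≤ toℕ (g x)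
  below zero    x _ = z≤n
  below (suc j) x x≡1+j = ℕₚ.<-≤-trans (s≤s (below j x′ (Finₚ.toℕ-fromℕ< j<k))) (incr x′<x)
    where
    j<k : j ℕ.< k
    j<k = ℕₚ.<-trans (ℕₚ.≤-reflexive (sym x≡1+j)) (Finₚ.toℕ<n x)
    x′ = fromℕ< j<k
    x′<x : x′ Fin.< x
    x′<x = ℕₚ.≤-reflexive (trans (cong suc (Finₚ.toℕ-fromℕ< j<k)) (sym x≡1+j))

-- conjugating by opposite turns the lower bound into an upper bound
strictlyIncreasing⇒id : (g : Fin k → Fin k) → StrictlyIncreasing g → ∀ x → g x ≡ x
strictlyIncreasing⇒id g incr x = Finₚ.≤-antisym g≤ (strictlyIncreasing⇒≥ g incr x)
  where
  g′ = opposite ∘ g ∘ opposite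
  incr′ : StrictlyIncreasing g′
  incr′ = opposite-< ∘ incr ∘ opposite-<
  g≤ : g x Fin.≤ x
  g≤ = Equivalence.to (opposite-≤ x (g x))
         (subst (λ z → opposite x Fin.≤ opposite (g z)) (Finₚ.opposite-involutive x)
           (strictlyIncreasing⇒≥ g′ incr′ (opposite x)))

≤-reflecting⇒id : (f g : Fin k → Fin k) → (∀ x y → f x Fin.≤ g y ⇔ x Fin.≤ y) →
                  (∀ x → f x ≡ x) × (∀ y → g y ≡ y)
≤-reflecting⇒id f g reflects = f-id , g-id
  where
  g-incr : StrictlyIncreasing g
  g-incr {y} {x} y<x = ℕₚ.<-≤-trans
    (ℕₚ.≰⇒> (ℕₚ.<⇒≱ y<x ∘ Equivalence.to (reflects x y)))
    (Equivalence.from (reflects x x) ℕₚ.≤-refl)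
  g-id = strictlyIncreasing⇒id g g-incr
  f-id : ∀ x → f x ≡ x
  f-id x = Finₚ.≤-antisym
    (subst (f x Fin.≤_) (g-id x) (Equivalence.from (reflects x x) ℕₚ.≤-refl))
    (Equivalence.to (reflects x (f x)) (subst (f x Fin.≤_) (sym (g-id (f x))) ℕₚ.≤-refl))

eqb-opposite : (x p : Fin k) → eqb (opposite x) p ≡ eqb x (opposite p)
eqb-opposite x p with x ≟ opposite p
... | yes refl = ≡⇒eqb (Finₚ.opposite-involutive p)
... | no x≢op  = eqb-≢ (λ ox≡p → x≢op (trans (sym (Finₚ.opposite-involutive x)) (cong opposite ox≡p)))

opposite-moves : 2 ≤ k → ∃ λ (x : Fin k) → opposite x ≢ x
opposite-moves {suc zero}    (s≤s ())
opposite-moves {suc (suc _)} _ = Fin.zero , λ ()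

adj⇒≢ : (X : Graph) {x y : Vertex X} → adj X x y ≡ true → x ≢ y
adj⇒≢ X {x} xy refl = contradiction (trans (sym xy) (adj-irrefl X x)) λ ()

Aut⁻¹ : Aut X → Aut X
Aut⁻¹ {X} φ = record
  { fun = inv φ ; inv = fun φ ; inv-left = inv-right φ ; inv-right = inv-left φ
  ; preserves = λ x y → trans (sym (preserves φ (inv φ x) (inv φ y)))
                              (cong₂ (adj X) (inv-right φ x) (inv-right φ y))
  }

Reach-trans : {x y z : Vertex X} → Reach X x y → Reach X y z → Reach X x z
Reach-trans here       r′ = r′
Reach-trans (step e r) r′ = step e (Reach-trans r r′)

connected⇒neighbour : Connected X → 2 ≤ order X → ∀ x → ∃ λ y → adj X x y ≡ true
connected⇒neighbour {X} conn 2≤n x with ∃-≢ 2≤n x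
... | y , x≢y = first-step (conn x y) x≢y
  where
  first-step : ∀ {x y} → Reach X x y → x ≢ y → ∃ λ z → adj X x z ≡ true
  first-step here       x≢x = contradiction refl x≢x
  first-step (step e _) _   = _ , e

order≤1⇒distinguishing : (X : Graph) → order X ≤ 1 → HasDistinguishingLabeling X 1
order≤1⇒distinguishing X n≤1 =
  record { label = λ _ _ → Fin.zero ; label-sym = λ _ _ _ → refl } , λ φ _ x → unique (fun φ x) x
  where
  unique : (x y : Vertex X) → x ≡ y
  unique x y = Finₚ.toℕ-injective (trans (zero′ x) (sym (zero′ y)))
    where zero′ = λ (z : Vertex X) → ℕₚ.n<1⇒n≡0 (ℕₚ.<-≤-trans (Finₚ.toℕ<n z) n≤1)

incident : Fin k → Fin k → Fin k → Bool
incident p x y = eqb x p ∨ eqb y p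

incident-here : (p y : Fin k) → incident p p y ≡ true
incident-here p y = cong (_∨ eqb y p) (eqb-refl p)

incident-other : {p x y : Fin k} → incident p x y ≡ true → x ≢ p → y ≡ p
incident-other {p = p} {x} {y} inc x≢p = eqb⇒≡ (subst (λ e → (e ∨ eqb y p) ≡ true) (eqb-≢ x≢p) inc)

-- if p ≢ q then every edge at p ends at q and vice versa, so every walk from p stays in {p, q}
incident-injective : (H : Graph) → Connected H → 3 ≤ order H → {p q : Vertex H} →
  (∀ x y → adj H x y ≡ true → incident p x y ≡ incident q x y) → p ≡ q
incident-injective H conH 3≤m {p} {q} agree with p ≟ q
... | yes p≡q = p≡q
... | no p≢q = contradiction (Finₚ.injective⇒≤ classify-injective) (ℕₚ.<⇒≱ 3≤m)
  where
  PorQ : Vertex H → Set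
  PorQ v = v ≡ p ⊎ v ≡ q

  cross : ∀ {u v} → PorQ u → adj H u v ≡ true → PorQ v
  cross (inj₁ refl) uv = inj₂ (incident-other (trans (sym (agree _ _ uv)) (incident-here p _)) p≢q)
  cross (inj₂ refl) uv = inj₁ (incident-other (trans (agree _ _ uv) (incident-here q _)) (p≢q ∘ sym))

  covered : ∀ {u v} → Reach H u v → PorQ u → PorQ v
  covered here       pu = pu
  covered (step e r) pu = covered r (cross pu e)

  classify : Vertex H → Fin 2
  classify v = bit (eqb v p)

  classify-injective : Injective _≡_ _≡_ classify
  classify-injective {v} {w} e with covered (conH p v) (inj₁ refl) | covered (conH p w) (inj₁ refl)
  ... | inj₁ refl | inj₁ refl = refl
  ... | inj₂ refl | inj₂ refl = refl
  ... | inj₁ refl | inj₂ refl =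
    contradiction (eqb⇒≡ (trans (sym (bit-injective e)) (eqb-refl p))) (p≢q ∘ sym)
  ... | inj₂ refl | inj₁ refl =
    contradiction (eqb⇒≡ (trans (bit-injective e) (eqb-refl p))) (p≢q ∘ sym)

incident-opposite : (p x y : Fin k) → incident p (opposite x) (opposite y) ≡ incident (opposite p) x y
incident-opposite p x y = cong₂ _∨_ (eqb-opposite x p) (eqb-opposite y p)

closedAdj : (X : Graph) → Vertex X → Vertex X → Bool
closedAdj X a d = adj X a d ∨ eqb a d

closedAdj-sym : ∀ (X : Graph) a d → closedAdj X a d ≡ closedAdj X d a
closedAdj-sym X a d = cong₂ _∨_ (adj-sym X a d) (eqb-sym a d)

closedAdj-refl : ∀ (X : Graph) a → closedAdj X a a ≡ true
closedAdj-refl X a = trans (cong (adj X a a ∨_) (eqb-refl a)) (∨-zeroʳ _)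

closedAdj-≢ : ∀ (X : Graph) {a d} → a ≢ d → closedAdj X a d ≡ adj X a d
closedAdj-≢ X {a} {d} a≢d = trans (cong (adj X a d ∨_) (eqb-≢ a≢d)) (∨-identityʳ _)

record TrueTwins (X : Graph) (a b : Vertex X) : Set where
  field
    distinct      : a ≢ b
    same-closedAdj : ∀ d → closedAdj X a d ≡ closedAdj X b d

sharedNeighbours⇒trueTwins : (X : Graph) {a b : Vertex X} → adj X a b ≡ true →
  (∀ c → adj X c a ≡ true → c ≢ b → adj X c b ≡ true) →
  (∀ c → adj X c b ≡ true → c ≢ a → adj X c a ≡ true) → TrueTwins X a b
sharedNeighbours⇒trueTwins X {a} {b} ab a→b b→a = record
  { distinct = adj⇒≢ X ab ; same-closedAdj = same }
  where
  ba = trans (adj-sym X b a) ab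
  same : ∀ d → closedAdj X a d ≡ closedAdj X b d
  same d with d ≟ a | d ≟ b
  ... | yes refl | _ =
    trans (closedAdj-refl X d) (sym (trans (closedAdj-≢ X (adj⇒≢ X ba)) ba))
  ... | no d≢a | yes refl =
    trans (trans (closedAdj-≢ X (adj⇒≢ X ab)) ab) (sym (closedAdj-refl X d))
  ... | no d≢a | no d≢b = begin
    closedAdj X a d ≡⟨ closedAdj-≢ X (d≢a ∘ sym) ⟩
    adj X a d       ≡⟨ adj-sym X a d ⟩
    adj X d a       ≡⟨ ⇔→≡ (mk⇔ (λ da → a→b d da d≢b) (λ db → b→a d db d≢a)) ⟩
    adj X d b       ≡⟨ adj-sym X d b ⟩
    adj X b d       ≡⟨ closedAdj-≢ X (d≢b ∘ sym) ⟨
    closedAdj X b d ∎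
    where open ≡-Reasoning

record JoinDecomposition (X : Graph) : Set where
  field
    side       : Vertex X → Bool
    left       : Vertex X
    left-side  : side left ≡ true
    right      : Vertex X
    right-side : side right ≡ false
    complete   : ∀ x y → side x ≡ true → side y ≡ false → adj X x y ≡ true

edge-twins×join : (G : Graph) → order G ≡ 2 → ∀ {a b} → adj G a b ≡ true →
                  TrueTwins G a b × JoinDecomposition G
edge-twins×join G n≡2 {a} {b} ab =
  sharedNeighbours⇒trueTwins G ab (λ c ca c≢b → ⊥-elim (c≢b (other (adj⇒≢ G ca))))
                                 (λ c cb c≢a → ⊥-elim (adj⇒≢ G cb (other c≢a))) ,
  record
    { side = λ x → eqb x a
    ; left = a ; left-side = eqb-refl a
    ; right = b ; right-side = eqb-≢ (adj⇒≢ G ab ∘ sym)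
    ; complete = λ x y xa ya →
        subst₂ (λ u v → adj G u v ≡ true) (sym (eqb⇒≡ xa)) (sym (other (eqb-false⇒≢ ya))) ab
    }
  where
  other : ∀ {c} → c ≢ a → c ≡ b
  other {c} c≢a with only-two n≡2 a b c (adj⇒≢ G ab)
  ... | inj₁ c≡a = contradiction c≡a c≢a
  ... | inj₂ c≡b = c≡b

-- Lexicographic products

module Lex (G H : Graph) where
  private
    n = order G
    m = order H

  layer : Vertex (G [ H ]) → Vertex G
  layer u = proj₁ (remQuot {n} m u)

  pos : Vertex (G [ H ]) → Vertex H
  pos u = proj₂ (remQuot {n} m u)

  combine-layer-pos : ∀ u → combine (layer u) (pos u) ≡ u
  combine-layer-pos u = Finₚ.combine-remQuot {n} m u

  layer-combine : ∀ a x → layer (combine a x) ≡ a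
  layer-combine a x = cong proj₁ (Finₚ.remQuot-combine {n} {m} a x)

  pos-combine : ∀ a x → pos (combine a x) ≡ x
  pos-combine a x = cong proj₂ (Finₚ.remQuot-combine {n} {m} a x)

  adj-combine : ∀ a x b y →
    adj (G [ H ]) (combine a x) (combine b y) ≡ (adj G a b ∨ (eqb a b ∧ adj H x y))
  adj-combine a x b y =
    cong₂ (λ u v → adj G (proj₁ u) (proj₁ v) ∨ (eqb (proj₁ u) (proj₁ v) ∧ adj H (proj₂ u) (proj₂ v)))
          (Finₚ.remQuot-combine {n} {m} a x) (Finₚ.remQuot-combine {n} {m} b y)

  adj-sameLayer : ∀ a x y → adj (G [ H ]) (combine a x) (combine a y) ≡ adj H x y
  adj-sameLayer a x y = trans (adj-combine a x a y)
    (cong₂ (λ e f → e ∨ (f ∧ adj H x y)) (adj-irrefl G a) (eqb-refl a))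

  relayer : (Vertex H → Vertex G → Vertex G) → Vertex (G [ H ]) → Vertex (G [ H ])
  relayer f u = combine (f (pos u) (layer u)) (pos u)

  relayer-combine : ∀ f a x → relayer f (combine a x) ≡ combine (f x a) x
  relayer-combine f a x = cong₂ (λ c z → combine (f z c) z) (layer-combine a x) (pos-combine a x)

  relayer-inverse : ∀ {f g} → (∀ x c → f x (g x c) ≡ c) → ∀ u → relayer f (relayer g u) ≡ u
  relayer-inverse {f} {g} fg u = begin
    relayer f (relayer g u)                           ≡⟨ relayer-combine f _ (pos u) ⟩
    combine (f (pos u) (g (pos u) (layer u))) (pos u) ≡⟨ cong (λ c → combine c (pos u)) (fg (pos u) (layer u)) ⟩
    combine (layer u) (pos u)                         ≡⟨ combine-layer-pos u ⟩
    u                                                 ∎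
    where open ≡-Reasoning

  adj-samePos : ∀ a b z → adj (G [ H ]) (combine a z) (combine b z) ≡ adj G a b
  adj-samePos a b z = trans (adj-combine a z b z)
    (trans (cong (λ e → adj G a b ∨ (eqb a b ∧ e)) (adj-irrefl H z))
      (trans (cong (adj G a b ∨_) (∧-zeroʳ (eqb a b))) (∨-identityʳ (adj G a b))))

  adj-otherLayer : ∀ u v → layer u ≢ layer v → adj (G [ H ]) u v ≡ adj G (layer u) (layer v)
  adj-otherLayer u v ≢ =
    trans (cong (λ e → adj G (layer u) (layer v) ∨ (e ∧ adj H (pos u) (pos v))) (eqb-≢ ≢)) (∨-identityʳ _)

  adj-fromLayer : ∀ c z u → c ≢ layer u → adj (G [ H ]) (combine c z) u ≡ adj G c (layer u)
  adj-fromLayer c z u c≢ = trans (adj-otherLayer (combine c z) u (c≢ ∘ trans (sym (layer-combine c z))))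
                                 (cong (λ d → adj G d (layer u)) (layer-combine c z))

  adj-toLayer : ∀ u c z → layer u ≢ c → adj (G [ H ]) u (combine c z) ≡ adj G (layer u) c
  adj-toLayer u c z ≢c = trans (adj-sym (G [ H ]) u (combine c z))
    (trans (adj-fromLayer c z u (≢c ∘ sym)) (adj-sym G c (layer u)))

  adj-acrossEdge : ∀ {a b} x y → adj G a b ≡ true → adj (G [ H ]) (combine a x) (combine b y) ≡ true
  adj-acrossEdge {a} {b} x y ab = trans (adj-combine a x b y) (cong (_∨ (eqb a b ∧ adj H x y)) ab)

LayersPreserved : Graph → Graph → Set
LayersPreserved G H =
  ∀ (φ : Aut (G [ H ])) (a : Vertex G) (x y : Vertex H) →
    Lex.layer G H (fun φ (combine a x)) ≡ Lex.layer G H (fun φ (combine a y))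

lex-connected : (G H : Graph) → Connected G → 2 ≤ order G → Connected (G [ H ])
lex-connected G H conG 2≤n u v =
  subst₂ (Reach (G [ H ])) (combine-layer-pos u) (combine-layer-pos v)
    (Reach-trans (along (conG (layer u) (layer v)) (pos u)) (within (layer v) (pos u) (pos v)))
  where
  open Lex G H
  along : ∀ {a b} → Reach G a b → ∀ x → Reach (G [ H ]) (combine a x) (combine b x)
  along here       x = here
  along (step e r) x = step (adj-acrossEdge x x e) (along r x)
  -- two vertices of one layer are joined through a neighbouring layer
  within : ∀ a x y → Reach (G [ H ]) (combine a x) (combine a y)
  within a x y with connected⇒neighbour conG 2≤n a
  ... | c , ac = step (adj-acrossEdge x x ac)
                   (step (adj-acrossEdge x y (trans (adj-sym G c a) ac)) here)

lexPow-connected : (G : Graph) → Connected G → 2 ≤ order G → ∀ j → Connected (lexPow G (suc j))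
lexPow-connected G conG 2≤n zero    = conG
lexPow-connected G conG 2≤n (suc j) = lex-connected G (lexPow G (suc j)) conG 2≤n

order≤lexPow : (G : Graph) → 1 ≤ order G → ∀ j → order G ≤ order (lexPow G (suc j))
order≤lexPow G 1≤n zero    = ℕₚ.≤-refl
order≤lexPow G 1≤n (suc j) = ℕₚ.≤-trans (ℕₚ.≤-reflexive (sym (ℕₚ.*-identityʳ (order G))))
  (ℕₚ.*-monoʳ-≤ (order G) (ℕₚ.≤-trans 1≤n (order≤lexPow G 1≤n j)))

lexPow-order≤1 : (G : Graph) → order G ≤ 1 → ∀ k → order (lexPow G k) ≤ 1
lexPow-order≤1 G n≤1 zero          = n≤1
lexPow-order≤1 G n≤1 (suc zero)    = n≤1
lexPow-order≤1 G n≤1 (suc (suc k)) = ℕₚ.*-mono-≤ n≤1 (lexPow-order≤1 G n≤1 (suc k))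

module _ (G H : Graph) (J : JoinDecomposition (G [ H ])) where
  open Lex G H
  open JoinDecomposition J

  layerJoin : ∀ a x y → side (combine a x) ≡ true → side (combine a y) ≡ false →
              JoinDecomposition H
  layerJoin a x y ax ay = record
    { side = λ z → side (combine a z)
    ; left = x ; left-side = ax ; right = y ; right-side = ay
    ; complete = λ z z′ az az′ → trans (sym (adj-sameLayer a z z′)) (complete _ _ az az′)
    }

  positionJoin : ∀ a b z → side (combine a z) ≡ true → side (combine b z) ≡ false →
                 JoinDecomposition G
  positionJoin a b z az bz = record
    { side = λ c → side (combine c z)
    ; left = a ; left-side = az ; right = b ; right-side = bz
    ; complete = λ c d cz dz → trans (sym (adj-samePos c d z)) (complete _ _ cz dz)
    }

  -- (layer left, pos right) is separated from left inside a layer or from right inside a position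
  lex-join : JoinDecomposition G ⊎ JoinDecomposition H
  lex-join with side (combine (layer left) (pos right)) in e
  ... | false = inj₂ (layerJoin (layer left) (pos left) (pos right) left′ e)
    where left′ = trans (cong side (combine-layer-pos left)) left-side
  ... | true  = inj₁ (positionJoin (layer left) (layer right) (pos right) e right′)
    where right′ = trans (cong side (combine-layer-pos right)) right-side

lexPow-join : (G : Graph) → ∀ j → JoinDecomposition (lexPow G (suc j)) → JoinDecomposition G
lexPow-join G zero    J = J
lexPow-join G (suc j) J with lex-join G (lexPow G (suc j)) J
... | inj₁ J′ = J′
... | inj₂ J′ = lexPow-join G j J′

-- Twins over a join

module TwinSwap (G : Graph) {a b : Vertex G} (tw : TrueTwins G a b) (J : JoinDecomposition G) where
  open TrueTwins tw
  open JoinDecomposition J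
  open Lex G G

  transpose-closedAdj : ∀ c d → closedAdj G (transpose a b c) d ≡ closedAdj G c d
  transpose-closedAdj c d with c ≟ a
  ... | yes refl = sym (same-closedAdj d)
  ... | no _ with c ≟ b
  ...   | yes refl = same-closedAdj d
  ...   | no _     = refl

  transpose-injective : Injective _≡_ _≡_ (transpose a b)
  transpose-injective {c} {d} e =
    trans (sym (transpose-inverse b a)) (trans (cong (transpose b a) e) (transpose-inverse b a))

  transpose-eqb : ∀ c d → eqb (transpose a b c) (transpose a b d) ≡ eqb c d
  transpose-eqb c d with c ≟ d
  ... | yes refl = eqb-refl (transpose a b c)
  ... | no c≢d   = eqb-≢ (c≢d ∘ transpose-injective)

  -- off the diagonal adjacency is closed adjacency, which the twins share
  transpose-adj : ∀ c d → adj G (transpose a b c) (transpose a b d) ≡ adj G c d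
  transpose-adj c d with c ≟ d
  ... | yes refl = trans (adj-irrefl G _) (sym (adj-irrefl G c))
  ... | no c≢d = begin
    adj G (t c) (t d)       ≡⟨ closedAdj-≢ G (c≢d ∘ transpose-injective) ⟨
    closedAdj G (t c) (t d) ≡⟨ transpose-closedAdj c (t d) ⟩
    closedAdj G c (t d)     ≡⟨ closedAdj-sym G c (t d) ⟩
    closedAdj G (t d) c     ≡⟨ transpose-closedAdj d c ⟩
    closedAdj G d c         ≡⟨ closedAdj-sym G d c ⟩
    closedAdj G c d         ≡⟨ closedAdj-≢ G c≢d ⟩
    adj G c d               ∎
    where
    open ≡-Reasoning
    t = transpose a b

  swapAt : Vertex G → Vertex G → Vertex G
  swapAt x c = if side x then transpose a b c else c

  unswapAt : Vertex G → Vertex G → Vertex G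
  unswapAt x c = if side x then transpose b a c else c

  adj-withEdge : ∀ {x y} c d → adj G x y ≡ true → (adj G c d ∨ (eqb c d ∧ adj G x y)) ≡ closedAdj G c d
  adj-withEdge c d xy =
    trans (cong (λ e → adj G c d ∨ (eqb c d ∧ e)) xy) (cong (adj G c d ∨_) (∧-identityʳ (eqb c d)))

  swapAt-preserves : ∀ c d x y →
    (adj G (swapAt x c) (swapAt y d) ∨ (eqb (swapAt x c) (swapAt y d) ∧ adj G x y))
      ≡ (adj G c d ∨ (eqb c d ∧ adj G x y))
  swapAt-preserves c d x y with side x in sx | side y in sy
  ... | false | false = refl
  ... | true  | true  = cong₂ (λ e f → e ∨ (f ∧ adj G x y)) (transpose-adj c d) (transpose-eqb c d)
  ... | true  | false = begin
    _                               ≡⟨ adj-withEdge _ d xy ⟩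
    closedAdj G (transpose a b c) d ≡⟨ transpose-closedAdj c d ⟩
    closedAdj G c d                 ≡⟨ adj-withEdge c d xy ⟨
    _                               ∎
    where open ≡-Reasoning
          xy = complete x y sx sy
  ... | false | true = begin
    _                               ≡⟨ adj-withEdge c _ xy ⟩
    closedAdj G c (transpose a b d) ≡⟨ closedAdj-sym G c _ ⟩
    closedAdj G (transpose a b d) c ≡⟨ transpose-closedAdj d c ⟩
    closedAdj G d c                 ≡⟨ closedAdj-sym G d c ⟩
    closedAdj G c d                 ≡⟨ adj-withEdge c d xy ⟨
    _                               ∎
    where open ≡-Reasoning
          xy = trans (adj-sym G x y) (complete y x sy sx)

  swap : Aut (G [ G ])
  swap = record
    { fun = relayer swapAt
    ; inv = relayer unswapAt
    ; inv-left = relayer-inverse {unswapAt} {swapAt} unswap-swap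
    ; inv-right = relayer-inverse {swapAt} {unswapAt} swap-unswap
    ; preserves = λ u v → trans (adj-combine _ _ _ _) (swapAt-preserves (layer u) (layer v) (pos u) (pos v))
    }
    where
    unswap-swap : ∀ x c → unswapAt x (swapAt x c) ≡ c
    unswap-swap x c with side x
    ... | true  = transpose-inverse b a
    ... | false = refl
    swap-unswap : ∀ x c → swapAt x (unswapAt x c) ≡ c
    swap-unswap x c with side x
    ... | true  = transpose-inverse a b
    ... | false = refl

  transpose-left : transpose a b a ≡ b
  transpose-left with a ≟ a
  ... | yes _  = refl
  ... | no a≢a = contradiction refl a≢a

  -- swap sends (a, left) to layer b but (a, right) to layer a
  swap-∉-wreath : ¬ InWreath G G swap
  swap-∉-wreath (α , β , swap≡) = distinct (begin
    a               ≡⟨ cong (λ s → if s then transpose a b a else a) right-side ⟨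
    swapAt right a  ≡⟨ lands right ⟩
    fun α a         ≡⟨ lands left ⟨
    swapAt left a   ≡⟨ cong (λ s → if s then transpose a b a else a) left-side ⟩
    transpose a b a ≡⟨ transpose-left ⟩
    b               ∎)
    where
    open ≡-Reasoning
    lands : ∀ z → swapAt z a ≡ fun α a
    lands z = Finₚ.combine-injectiveˡ _ z _ _ (trans (sym (relayer-combine swapAt a z)) (swap≡ a z))

twins×join⇒¬wreath : (G : Graph) {a b : Vertex G} → TrueTwins G a b → JoinDecomposition G →
                     ¬ AutLexIsWreath G G
twins×join⇒¬wreath G tw J wreath = swap-∉-wreath (wreath swap)
  where open TwinSwap G tw J

order2⇒¬wreath : (G : Graph) → Connected G → order G ≡ 2 → ¬ AutLexIsWreath G G
order2⇒¬wreath G conG n≡2 with connected⇒neighbour conG 2≤n (fromℕ< (ℕₚ.<-trans (s≤s z≤n) 2≤n))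
  where 2≤n = ℕₚ.≤-reflexive (sym n≡2)
... | _ , ab = twins×join⇒¬wreath G (proj₁ tw×J) (proj₂ tw×J)
  where tw×J = edge-twins×join G n≡2 ab

-- Images of layers

module LayerImage (G H : Graph) (φ : Aut (G [ H ])) (a₀ : Vertex G) where
  open Lex G H
  private
    f = fun φ
    g = inv φ

  image : Vertex H → Vertex (G [ H ])
  image s = f (combine a₀ s)

  imageLayer : Vertex H → Vertex G
  imageLayer s = layer (image s)

  Escapes : Vertex (G [ H ]) → Set
  Escapes w = layer (g w) ≢ a₀

  -- the image of a layer is a module: outside vertices see all of it or none of it
  adj-image : ∀ w s → Escapes w → adj (G [ H ]) w (image s) ≡ adj G (layer (g w)) a₀
  adj-image w s esc = begin
    adj (G [ H ]) w (image s)          ≡⟨ preserves (Aut⁻¹ φ) w (image s) ⟨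
    adj (G [ H ]) (g w) (g (image s))  ≡⟨ cong (adj (G [ H ]) (g w)) (inv-left φ (combine a₀ s)) ⟩
    adj (G [ H ]) (g w) (combine a₀ s) ≡⟨ adj-toLayer (g w) a₀ s esc ⟩
    adj G (layer (g w)) a₀             ∎
    where open ≡-Reasoning

  image-module : ∀ w s t → Escapes w → adj (G [ H ]) w (image s) ≡ adj (G [ H ]) w (image t)
  image-module w s t esc = trans (adj-image w s esc) (sym (adj-image w t esc))

  preimage-pos : Vertex G → Vertex H → Vertex H
  preimage-pos c z = pos (g (combine c z))

  image-preimage : ∀ c z → layer (g (combine c z)) ≡ a₀ → image (preimage-pos c z) ≡ combine c z
  image-preimage c z inA₀ = begin
    f (combine a₀ (preimage-pos c z))                        ≡⟨ cong (λ a → f (combine a (preimage-pos c z))) inA₀ ⟨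
    f (combine (layer (g (combine c z))) (preimage-pos c z)) ≡⟨ cong f (combine-layer-pos _) ⟩
    f (g (combine c z))                                      ≡⟨ inv-right φ (combine c z) ⟩
    combine c z                                              ∎
    where open ≡-Reasoning

  -- a layer with no escaping vertex has as many vertices as layer a₀, so it is the whole image
  image-inLayer : ∀ c → (∀ z → layer (g (combine c z)) ≡ a₀) → ∀ s → imageLayer s ≡ c
  image-inLayer c inA₀ s with injective⇒surjective (preimage-pos c) injective s
    where
    injective : Injective _≡_ _≡_ (preimage-pos c)
    injective {z} {z′} e = Finₚ.combine-injectiveʳ c z c z′
      (trans (sym (image-preimage c z (inA₀ z))) (trans (cong image e) (image-preimage c z′ (inA₀ z′))))
  ... | z , refl = trans (cong layer (image-preimage c z (inA₀ z))) (layer-combine c z)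

  image-inLayer⊎escape : ∀ c → (∀ s → imageLayer s ≡ c) ⊎ ∃ λ z → Escapes (combine c z)
  image-inLayer⊎escape c with Finₚ.all? (λ z → layer (g (combine c z)) ≟ a₀)
  ... | yes inA₀ = inj₁ (image-inLayer c inA₀)
  ... | no ¬inA₀ = inj₂ (Finₚ.¬∀⟶∃¬ (order H) _ (λ z → layer (g (combine c z)) ≟ a₀) ¬inA₀)

  neighbour-shared : ∀ {s t} → imageLayer s ≢ imageLayer t →
    ∀ c → adj G c (imageLayer s) ≡ true → c ≢ imageLayer t → adj G c (imageLayer t) ≡ true
  neighbour-shared {s} {t} s≢t c cs c≢t with image-inLayer⊎escape c
  ... | inj₁ inC = contradiction (trans (inC s) (sym (inC t))) s≢t
  ... | inj₂ (z , esc) = begin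
    adj G c (imageLayer t)                ≡⟨ adj-fromLayer c z (image t) c≢t ⟨
    adj (G [ H ]) (combine c z) (image t) ≡⟨ image-module (combine c z) s t esc ⟨
    adj (G [ H ]) (combine c z) (image s) ≡⟨ adj-fromLayer c z (image s) (adj⇒≢ G cs) ⟩
    adj G c (imageLayer s)                ≡⟨ cs ⟩
    true                                  ∎
    where open ≡-Reasoning

  module _ {x y : Vertex H} (xy : adj H x y ≡ true) (split : imageLayer x ≢ imageLayer y) where
    private
      a = imageLayer x
      b = imageLayer y

    ab : adj G a b ≡ true
    ab = trans (sym (adj-otherLayer (image x) (image y) split))
              (trans (preserves φ _ _) (trans (adj-sameLayer a₀ x y) xy))

    split-twins : TrueTwins G a b
    split-twins = sharedNeighbours⇒trueTwins G ab (neighbour-shared split) (neighbour-shared (split ∘ sym))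

    split-join : JoinDecomposition H
    split-join = record
      { side = side
      ; left = pos (image x) ; left-side = left-side
      ; right = proj₁ escape ; right-side = eqb-≢ (proj₂ escape)
      ; complete = complete
      }
      where
      side : Vertex H → Bool
      side z = eqb (layer (g (combine a z))) a₀

      left-side : side (pos (image x)) ≡ true
      left-side = ≡⇒eqb (begin
        layer (g (combine a (pos (image x)))) ≡⟨ cong (layer ∘ g) (combine-layer-pos (image x)) ⟩
        layer (g (image x))                   ≡⟨ cong layer (inv-left φ (combine a₀ x)) ⟩
        layer (combine a₀ x)                  ≡⟨ layer-combine a₀ x ⟩
        a₀                                    ∎)
        where open ≡-Reasoning

      escape : ∃ λ z → Escapes (combine a z)
      escape with image-inLayer⊎escape a
      ... | inj₁ inA = contradiction (sym (inA y)) split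
      ... | inj₂ esc = esc

      -- (a, q) escapes and sees image y, hence all of the image, in particular (a, p)
      complete : ∀ p q → side p ≡ true → side q ≡ false → adj H p q ≡ true
      complete p q sp sq = begin
        adj H p q                                              ≡⟨ adj-sym H p q ⟩
        adj H q p                                              ≡⟨ adj-sameLayer a q p ⟨
        adj (G [ H ]) (combine a q) (combine a p)              ≡⟨ cong (adj (G [ H ]) (combine a q)) (image-preimage a p (eqb⇒≡ sp)) ⟨
        adj (G [ H ]) (combine a q) (image (preimage-pos a p)) ≡⟨ image-module (combine a q) _ y (eqb-false⇒≢ sq) ⟩
        adj (G [ H ]) (combine a q) (image y)                  ≡⟨ adj-fromLayer a q (image y) split ⟩
        adj G a b                                              ≡⟨ ab ⟩
        true                                                   ∎
        where open ≡-Reasoning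

NoTwinsOverJoin : Graph → Graph → Set
NoTwinsOverJoin G H = ∀ {a b} → TrueTwins G a b → JoinDecomposition H → ⊥

layers-preserved : (G H : Graph) → Connected H → NoTwinsOverJoin G H → LayersPreserved G H
layers-preserved G H conH noTwins φ a x y = along (conH x y)
  where
  open LayerImage G H φ a
  along : ∀ {x y} → Reach H x y → imageLayer x ≡ imageLayer y
  along here = refl
  along {x} (step {y = z} xz r) with imageLayer x ≟ imageLayer z
  ... | yes same = trans same (along r)
  ... | no split = ⊥-elim (noTwins (split-twins xz split) (split-join xz split))

-- The distinguishing labeling

module Labeling (G H : Graph) (n≤m : order G ≤ order H) where
  open Lex G H
  private
    n = order G

  ι : Vertex G → Vertex H
  ι a = Fin.inject≤ a n≤m

  isLast : Vertex G → Bool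
  isLast a = suc (toℕ a) ℕ.≡ᵇ n

  -- the last layer stays unmarked, since otherwise reversing the vertex orders of both G and H
  -- could preserve every label
  mark : Vertex G → Vertex H → Vertex H → Bool
  mark a x y = not (isLast a) ∧ incident (ι a) x y

  lab : Vertex G → Vertex H → Vertex G → Vertex H → Bool
  lab a x b y with Finₚ.<-cmp a b
  ... | tri< _ _ _ = does (x Fin.≤? y)
  ... | tri≈ _ _ _ = mark a x y
  ... | tri> _ _ _ = does (y Fin.≤? x)

  lab-< : ∀ {a b} x y → a Fin.< b → lab a x b y ≡ does (x Fin.≤? y)
  lab-< {a} {b} x y a<b with Finₚ.<-cmp a b
  ... | tri< _ _ _    = refl
  ... | tri≈ ¬a<b _ _ = contradiction a<b ¬a<b
  ... | tri> ¬a<b _ _ = contradiction a<b ¬a<b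

  lab-> : ∀ {a b} x y → b Fin.< a → lab a x b y ≡ does (y Fin.≤? x)
  lab-> {a} {b} x y b<a with Finₚ.<-cmp a b
  ... | tri< _ _ ¬b<a = contradiction b<a ¬b<a
  ... | tri≈ _ _ ¬b<a = contradiction b<a ¬b<a
  ... | tri> _ _ _    = refl

  lab-≡ : ∀ a x y → lab a x a y ≡ mark a x y
  lab-≡ a x y with Finₚ.<-cmp a a
  ... | tri< a<a _ _ = contradiction a<a (Finₚ.<-irrefl refl)
  ... | tri≈ _ _ _   = refl
  ... | tri> _ _ a<a = contradiction a<a (Finₚ.<-irrefl refl)

  lab-sym : ∀ a x b y → lab a x b y ≡ lab b y a x
  lab-sym a x b y with Finₚ.<-cmp a b
  ... | tri< a<b _ _  = sym (lab-> y x a<b)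
  ... | tri> _ _ b<a  = sym (lab-< y x b<a)
  ... | tri≈ _ refl _ =
    trans (cong (not (isLast a) ∧_) (∨-comm (eqb x (ι a)) (eqb y (ι a)))) (sym (lab-≡ a y x))

  ψ : EdgeLabeling (G [ H ]) 2
  ψ = record
    { label = λ u v → bit (lab (layer u) (pos u) (layer v) (pos v))
    ; label-sym = λ u v _ → cong bit (lab-sym (layer u) (pos u) (layer v) (pos v))
    }

  label-combine : ∀ a x b y → label ψ (combine a x) (combine b y) ≡ bit (lab a x b y)
  label-combine a x b y =
    cong₂ (λ u v → bit (lab (proj₁ u) (proj₂ u) (proj₁ v) (proj₂ v)))
          (Finₚ.remQuot-combine a x) (Finₚ.remQuot-combine b y)

  isLast⇒≡ : ∀ {a} → isLast a ≡ true → suc (toℕ a) ≡ n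
  isLast⇒≡ last = ℕₚ.≡ᵇ⇒≡ _ _ (Equivalence.from T-≡ last)

  ≡⇒isLast : ∀ {a} → suc (toℕ a) ≡ n → isLast a ≡ true
  ≡⇒isLast e = Equivalence.to T-≡ (ℕₚ.≡⇒≡ᵇ _ _ e)

  ≢⇒notLast : ∀ {a} → suc (toℕ a) ≢ n → isLast a ≡ false
  ≢⇒notLast {a} ≢ with isLast a in last
  ... | true  = contradiction (isLast⇒≡ last) ≢
  ... | false = refl

  marked⇒notLast : ∀ {a} x y → mark a x y ≡ true → isLast a ≡ false
  marked⇒notLast {a} x y marked with isLast a | marked
  ... | false | _  = refl
  ... | true  | ()

  mark-notLast : ∀ a x y → isLast a ≡ false → mark a x y ≡ incident (ι a) x y
  mark-notLast a x y notLast = cong (λ l → not l ∧ incident (ι a) x y) notLast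

  marked-edge : Connected H → 2 ≤ order H → ∀ a → isLast a ≡ false →
                ∃ λ x → ∃ λ y → adj H x y ≡ true × mark a x y ≡ true
  marked-edge conH 2≤m a notLast with connected⇒neighbour conH 2≤m (ι a)
  ... | y , e = ι a , y , e , trans (mark-notLast a (ι a) y notLast) (incident-here (ι a) y)

  module LabelPreserving (conG : Connected G) (conH : Connected H) (3≤n : 3 ≤ n)
    (layered : LayersPreserved G H)
    (φ : Aut (G [ H ])) (pres : PreservesLabels ψ φ) where
    private
      f = fun φ
      2≤n = ℕₚ.≤-trans (ℕₚ.n≤1+n 2) 3≤n
      2≤m = ℕₚ.≤-trans 2≤n n≤m
      3≤m = ℕₚ.≤-trans 3≤n n≤m

    α : Vertex G → Vertex G
    α a = layer (f (combine a (ι a)))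

    β : Vertex G → Vertex H → Vertex H
    β a x = pos (f (combine a x))

    f-combine : ∀ a x → f (combine a x) ≡ combine (α a) (β a x)
    f-combine a x = trans (sym (combine-layer-pos _)) (cong (λ c → combine c (β a x)) (layered φ a x (ι a)))

    lab-preserved : ∀ a x b y → adj (G [ H ]) (combine a x) (combine b y) ≡ true →
                    lab (α a) (β a x) (α b) (β b y) ≡ lab a x b y
    lab-preserved a x b y e = bit-injective (begin
      bit (lab (α a) (β a x) (α b) (β b y))                   ≡⟨ label-combine _ _ _ _ ⟨
      label ψ (combine (α a) (β a x)) (combine (α b) (β b y)) ≡⟨ cong₂ (label ψ) (f-combine a x) (f-combine b y) ⟨
      label ψ (f (combine a x)) (f (combine b y))             ≡⟨ pres _ _ e ⟩
      label ψ (combine a x) (combine b y)                     ≡⟨ label-combine a x b y ⟩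
      bit (lab a x b y)                                       ∎)
      where open ≡-Reasoning

    α-injective : Injective _≡_ _≡_ α
    α-injective {a} {b} e =
      trans (sym (preimage-layer a (ι a)))
            (trans (cong (λ c → layer (inv φ (combine c (ι a)))) e) (preimage-layer b (ι a)))
      where
      preimage-layer : ∀ a z → layer (inv φ (combine (α a) z)) ≡ a
      preimage-layer a z = begin
        layer (inv φ (combine (α a) z))           ≡⟨ layered (Aut⁻¹ φ) (α a) z (β a (ι a)) ⟩
        layer (inv φ (combine (α a) (β a (ι a)))) ≡⟨ cong (layer ∘ inv φ) (f-combine a (ι a)) ⟨
        layer (inv φ (f (combine a (ι a))))       ≡⟨ cong layer (inv-left φ _) ⟩
        layer (combine a (ι a))                   ≡⟨ layer-combine a (ι a) ⟩
        a                                         ∎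
        where open ≡-Reasoning

    Straight Reversed : Vertex G → Set
    Straight a = ∀ x → β a x ≡ x
    Reversed a = ∀ x → β a x ≡ opposite x

    ¬straight×reversed : ∀ {a} → Straight a → Reversed a → ⊥
    ¬straight×reversed st rev with opposite-moves 2≤m
    ... | x , moved = moved (trans (sym (rev x)) (st x))

    -- comparing positions across an edge of G is all the labels between two layers record,
    -- and only the identity or the reversal of H's vertex order respects that comparison
    ordered-edge-orientation : ∀ {a b} → adj G a b ≡ true → a Fin.< b →
      (Straight a × Straight b) ⊎ (Reversed a × Reversed b)
    ordered-edge-orientation {a} {b} ab a<b with Finₚ.<-cmp (α a) (α b)
    ... | tri< αa<αb _ _ = inj₁ (≤-reflecting⇒id (β a) (β b) reflects)
      where
      reflects : ∀ x y → β a x Fin.≤ β b y ⇔ x Fin.≤ y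
      reflects x y = does-≡⇒⇔ (β a x Fin.≤? β b y) (x Fin.≤? y)
        (trans (sym (lab-< _ _ αa<αb)) (trans (lab-preserved a x b y (adj-acrossEdge x y ab)) (lab-< x y a<b)))
    ... | tri≈ _ αa≡αb _ = contradiction (α-injective αa≡αb) (Finₚ.<⇒≢ a<b)
    ... | tri> _ _ αb<αa = inj₂ (reversed (proj₁ ids) , reversed (proj₂ ids))
      where
      reflects : ∀ x y → opposite (β a x) Fin.≤ opposite (β b y) ⇔ x Fin.≤ y
      reflects x y = ⇔-trans (opposite-≤ (β a x) (β b y)) (does-≡⇒⇔ (β b y Fin.≤? β a x) (x Fin.≤? y)
        (trans (sym (lab-> _ _ αb<αa)) (trans (lab-preserved a x b y (adj-acrossEdge x y ab)) (lab-< x y a<b))))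
      ids = ≤-reflecting⇒id (opposite ∘ β a) (opposite ∘ β b) reflects
      reversed : ∀ {c} → (∀ x → opposite (β c x) ≡ x) → Reversed c
      reversed {c} id x = trans (sym (Finₚ.opposite-involutive (β c x))) (cong opposite (id x))

    edge-orientation : ∀ {a b} → adj G a b ≡ true → (Straight a × Straight b) ⊎ (Reversed a × Reversed b)
    edge-orientation {a} {b} ab with Finₚ.<-cmp a b
    ... | tri< a<b _ _ = ordered-edge-orientation ab a<b
    ... | tri≈ _ a≡b _ = contradiction a≡b (adj⇒≢ G ab)
    ... | tri> _ _ b<a with ordered-edge-orientation (trans (adj-sym G b a) ab) b<a
    ...   | inj₁ (sb , sa) = inj₁ (sa , sb)
    ...   | inj₂ (rb , ra) = inj₂ (ra , rb)

    straight-spreads : ∀ {a b} → Reach G a b → Straight a → Straight b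
    straight-spreads here       st = st
    straight-spreads (step e r) st with edge-orientation e
    ... | inj₁ (_ , st′)   = straight-spreads r st′
    ... | inj₂ (rev , _)   = ⊥-elim (¬straight×reversed st rev)

    marks-preserved : ∀ a x y → adj H x y ≡ true → mark (α a) (β a x) (β a y) ≡ mark a x y
    marks-preserved a x y xy = trans (sym (lab-≡ (α a) _ _))
      (trans (lab-preserved a x a y (trans (adj-sameLayer a x y) xy)) (lab-≡ a x y))

    notLast-preserved : ∀ {a} → isLast a ≡ false → isLast (α a) ≡ false
    notLast-preserved {a} notLast with marked-edge conH 2≤m a notLast
    ... | x , y , xy , marked = marked⇒notLast (β a x) (β a y) (trans (marks-preserved a x y xy) marked)

    a₀ : Vertex G
    a₀ = fromℕ< (ℕₚ.<-trans (s≤s z≤n) 2≤n)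

    a₀-notLast : isLast a₀ ≡ false
    a₀-notLast = ≢⇒notLast λ 1≡n → ℕₚ.<⇒≢ 2≤n (trans (cong suc (sym (Finₚ.toℕ-fromℕ< _))) 1≡n)

    -- a reversed first layer would have to land on the last layer, which carries no marks
    ¬reversed-a₀ : Reversed a₀ → ⊥
    ¬reversed-a₀ rev = contradiction (trans (sym (≡⇒isLast c-last)) c-notLast) λ ()
      where
      c = α a₀
      c-notLast = notLast-preserved a₀-notLast
      agree : ∀ x y → adj H x y ≡ true → incident (opposite (ι c)) x y ≡ incident (ι a₀) x y
      agree x y xy = begin
        incident (opposite (ι c)) x y            ≡⟨ incident-opposite (ι c) x y ⟨
        incident (ι c) (opposite x) (opposite y) ≡⟨ cong₂ (incident (ι c)) (rev x) (rev y) ⟨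
        incident (ι c) (β a₀ x) (β a₀ y)         ≡⟨ mark-notLast c (β a₀ x) (β a₀ y) c-notLast ⟨
        mark c (β a₀ x) (β a₀ y)                 ≡⟨ marks-preserved a₀ x y xy ⟩
        mark a₀ x y                              ≡⟨ mark-notLast a₀ x y a₀-notLast ⟩
        incident (ι a₀) x y                      ∎
        where open ≡-Reasoning
      m∸c≡0 : order H ℕ.∸ suc (toℕ c) ≡ 0
      m∸c≡0 = begin
        order H ℕ.∸ suc (toℕ c)     ≡⟨ cong (λ k → order H ℕ.∸ suc k) (Finₚ.toℕ-inject≤ c n≤m) ⟨
        order H ℕ.∸ suc (toℕ (ι c)) ≡⟨ Finₚ.opposite-prop (ι c) ⟨
        toℕ (opposite (ι c))        ≡⟨ cong toℕ (incident-injective H conH 3≤m agree) ⟩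
        toℕ (ι a₀)                  ≡⟨ Finₚ.toℕ-inject≤ a₀ n≤m ⟩
        toℕ a₀                      ≡⟨ Finₚ.toℕ-fromℕ< _ ⟩
        0                           ∎
        where open ≡-Reasoning
      c-last : suc (toℕ c) ≡ n
      c-last = ℕₚ.≤-antisym (Finₚ.toℕ<n c) (ℕₚ.≤-trans n≤m (ℕₚ.m∸n≡0⇒m≤n m∸c≡0))

    straight-a₀ : Straight a₀
    straight-a₀ with connected⇒neighbour conG 2≤n a₀
    ... | b , e with edge-orientation e
    ...   | inj₁ (st , _) = st
    ...   | inj₂ (rev , _) = ⊥-elim (¬reversed-a₀ rev)

    straight : ∀ a → Straight a
    straight a = straight-spreads (conG a₀ a) straight-a₀

    marks-fixed : ∀ a x y → adj H x y ≡ true → mark (α a) x y ≡ mark a x y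
    marks-fixed a x y xy =
      trans (cong₂ (mark (α a)) (sym (straight a x)) (sym (straight a y))) (marks-preserved a x y xy)

    lastness-preserved : ∀ a → isLast (α a) ≡ isLast a
    lastness-preserved a = ⇔→≡ (mk⇔ notLast-reflected notLast-preserved)
      where
      notLast-reflected : isLast (α a) ≡ false → isLast a ≡ false
      notLast-reflected notLast with marked-edge conH 2≤m (α a) notLast
      ... | x , y , xy , marked = marked⇒notLast x y (trans (sym (marks-fixed a x y xy)) marked)

    -- the marked vertex ι a of layer a is recovered from the marked edges
    α-fixed : ∀ a → α a ≡ a
    α-fixed a with isLast a in last
    ... | true  = Finₚ.toℕ-injective (ℕₚ.suc-injective
                    (trans (isLast⇒≡ (trans (lastness-preserved a) last)) (sym (isLast⇒≡ last))))
    ... | false = Finₚ.inject≤-injective _ _ _ _ (incident-injective H conH 3≤m agree)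
      where
      agree : ∀ x y → adj H x y ≡ true → incident (ι (α a)) x y ≡ incident (ι a) x y
      agree x y xy = trans (sym (mark-notLast (α a) x y (trans (lastness-preserved a) last)))
                       (trans (marks-fixed a x y xy) (mark-notLast a x y last))

    fixes : ∀ u → f u ≡ u
    fixes u = begin
      f u                                         ≡⟨ cong f (combine-layer-pos u) ⟨
      f (combine (layer u) (pos u))               ≡⟨ f-combine (layer u) (pos u) ⟩
      combine (α (layer u)) (β (layer u) (pos u)) ≡⟨ cong₂ combine (α-fixed (layer u)) (straight (layer u) (pos u)) ⟩
      combine (layer u) (pos u)                   ≡⟨ combine-layer-pos u ⟩
      u                                           ∎
      where open ≡-Reasoning

distinguishing-lex : (G H : Graph) → Connected G → Connected H → 3 ≤ order G → order G ≤ order H →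
  NoTwinsOverJoin G H → HasDistinguishingLabeling (G [ H ]) 2
distinguishing-lex G H conG conH 3≤n n≤m noTwins =
  ψ , LabelPreserving.fixes conG conH 3≤n (layers-preserved G H conH noTwins)
  where open Labeling G H n≤m

distinguishing-lexPow : (G : Graph) → Connected G → 3 ≤ order G → AutLexIsWreath G G →
  ∀ j → HasDistinguishingLabeling (lexPow G (suc (suc j))) 2
distinguishing-lexPow G conG 3≤n wreath j =
  distinguishing-lex G H conG (lexPow-connected G conG 2≤n j) 3≤n (order≤lexPow G 1≤n j) noTwins
  where
  H = lexPow G (suc j)
  2≤n = ℕₚ.≤-trans (ℕₚ.n≤1+n 2) 3≤n
  1≤n = ℕₚ.≤-trans (ℕₚ.n≤1+n 1) 2≤n
  noTwins : NoTwinsOverJoin G H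
  noTwins tw J = twins×join⇒¬wreath G tw (lexPow-join G j J) wreath

corollary3p8 : (G : Graph) → Connected G → AutLexIsWreath G G →
    ∀ (k : ℕ) → 2 ≤ k → DistIndex≤ (lexPow G k) 2
corollary3p8 G conG wreath (suc zero) (s≤s ())
corollary3p8 G conG wreath (suc (suc j)) _ with order G ℕ.≤? 1 | order G ℕ.≟ 2
... | yes n≤1 | _      = 1 , s≤s z≤n , order≤1⇒distinguishing _ (lexPow-order≤1 G n≤1 (suc (suc j)))
... | no _    | yes n≡2 = ⊥-elim (order2⇒¬wreath G conG n≡2 wreath)
... | no n≰1  | no n≢2 = 2 , ℕₚ.≤-refl , distinguishing-lexPow G conG 3≤n wreath j
  where 3≤n = ℕₚ.≤∧≢⇒< (ℕₚ.≰⇒> n≰1) (n≢2 ∘ sym)
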